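{- Let $b\ge2$ and let $T$ be a balanced $b$-ary tree with $n$ vertices. Then for every vertex $v$ of $T$, $$n_v=\frac{n-\frac{b^{\mathrm{lev}(v)}-1}{b-1}}{b^{\mathrm{lev}(v)}}+\beta$$ for some real $\beta$ with $|\beta|\le 1$.
   Context: A $b$-ary tree is a rooted tree in which every vertex has at most $b$ children. $\mathrm{lev}(v)$ is the distance from $v$ to the root; the $\ell$-th level is the set of vertices at level $\ell$, and it is filled if it contains $b^\ell$ vertices. $n_x$ is the number of vertices in the subtree rooted at $x$. A rooted $b$-ary tree is balanced if (1) every non-empty level, except possibly the last non-empty one, is filled, and (2) for any two vertices $x,y$ on the same level, $|n_x-n_y|\le 1$. -}

module Defs where

open import Data.Nat as ℕ using (ℕ; zero; suc; _+_; _∸_; _^_; _≤_; _<_; s≤s; z≤n; ∣_-_∣)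
open import Data.Nat.Properties using (m^n≢0)
open import Data.Fin using (Fin; zero; suc)
open import Data.Integer using (+_)
open import Data.Rational using (ℚ; _/_; _-_; _*_)
open import Relation.Binary.PropositionalEquality using (_≡_)

-- Rooted (unordered in spirit) trees: a node with k children, given by Fin k → Tree.
data Tree : Set where
  node : (k : ℕ) → (Fin k → Tree) → Tree

sumFin : (k : ℕ) → (Fin k → ℕ) → ℕ
sumFin zero    f = 0
sumFin (suc k) f = f zero + sumFin k (λ i → f (suc i))

size : Tree → ℕ
size (node k f) = suc (sumFin k (λ i → size (f i)))

data IsBary (b : ℕ) : Tree → Set where
  node : ∀ {k f} → k ≤ b → (∀ i → IsBary b (f i)) → IsBary b (node k f)

-- vertices of a tree, as paths from the root
data Vertex : Tree → Set where
  root : ∀ {t} → Vertex t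
  down : ∀ {k f} (i : Fin k) → Vertex (f i) → Vertex (node k f)

lev : ∀ {t} → Vertex t → ℕ
lev root       = 0
lev (down i v) = suc (lev v)

subtree : (t : Tree) → Vertex t → Tree
subtree t          root       = t
subtree (node k f) (down i v) = subtree (f i) v

nSub : (t : Tree) → Vertex t → ℕ
nSub t v = size (subtree t v)

levelSize : Tree → ℕ → ℕ
levelSize t          zero    = 1
levelSize (node k f) (suc ℓ) = sumFin k (λ i → levelSize (f i) ℓ)

Filled : ℕ → Tree → ℕ → Set
Filled b t ℓ = levelSize t ℓ ≡ b ^ ℓ

NonEmptyLevel : Tree → ℕ → Set
NonEmptyLevel t ℓ = 0 < levelSize t ℓ

-- balanced b-ary tree:
-- (1) every non-empty level except possibly the last non-empty one is filled
--     (a non-empty level ℓ is not the last non-empty one iff some later level is non-empty)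
-- (2) vertices on the same level have subtree sizes differing by at most 1
record Balanced (b : ℕ) (t : Tree) : Set where
  field
    bary   : IsBary b t
    filled : ∀ ℓ m → ℓ < m → NonEmptyLevel t ℓ → NonEmptyLevel t m → Filled b t ℓ
    sizes  : (x y : Vertex t) → lev x ≡ lev y → ∣ nSub t x - nSub t y ∣ ≤ 1

formula : (b : ℕ) → 2 ≤ b → (n ℓ : ℕ) → ℚ
formula (suc (suc c)) (s≤s (s≤s z≤n)) n ℓ =
  ((+ n) / 1 - (+ (b ^ ℓ ∸ 1)) / (b ∸ 1)) * ((+ 1) / (b ^ ℓ))
  where
  b = suc (suc c)
  instance
    nz : ℕ.NonZero (b ^ ℓ)
    nz = m^n≢0 b ℓ

-- Let ℓ = lev v, B = b^ℓ, and let S be the number of vertices on levels ≥ ℓ, which is the sum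
-- of n_x over the vertices x of level ℓ. The levels above ℓ are filled, so
-- n = (B - 1)/(b - 1) + S and the claim becomes |n_v - S/B| ≤ 1, i.e. |n_v B - S| ≤ B.
-- If level ℓ + 1 is non-empty, level ℓ is filled: it has B vertices, each with n_x within 1
-- of n_v, so |n_v B - S| ≤ B. Otherwise level ℓ consists of at most B leaves, so n_v = 1
-- and S ≤ B.
module Submission where

open import Defs

module SumFin where
  open import Data.Nat using (ℕ; zero; suc; _+_; _*_; _≤_; z≤n; ∣_-_∣)
  open import Data.Nat.Properties
  open import Algebra.Properties.CommutativeSemigroup +-commutativeSemigroup using () renaming (interchange to +-interchange)
  open import Data.Fin using (Fin; zero; suc)
  open import Function using (_∘_)
  open import Relation.Binary.PropositionalEquality

  sumFin-cong : ∀ k {f g : Fin k → ℕ} → (∀ i → f i ≡ g i) → sumFin k f ≡ sumFin k g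
  sumFin-cong zero    f≗g = refl
  sumFin-cong (suc k) f≗g = cong₂ _+_ (f≗g zero) (sumFin-cong k (f≗g ∘ suc))

  sumFin-+ : ∀ k (f g : Fin k → ℕ) → sumFin k (λ i → f i + g i) ≡ sumFin k f + sumFin k g
  sumFin-+ zero    f g = refl
  sumFin-+ (suc k) f g = begin
    (f zero + g zero) + sumFin k (λ i → f (suc i) + g (suc i))
      ≡⟨ cong (f zero + g zero +_) (sumFin-+ k (f ∘ suc) (g ∘ suc)) ⟩
    (f zero + g zero) + (sumFin k (f ∘ suc) + sumFin k (g ∘ suc))
      ≡⟨ +-interchange (f zero) (g zero) _ _ ⟩
    (f zero + sumFin k (f ∘ suc)) + (g zero + sumFin k (g ∘ suc)) ∎
    where open ≡-Reasoning

  *-sumFin : ∀ k c (f : Fin k → ℕ) → c * sumFin k f ≡ sumFin k (λ i → c * f i)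
  *-sumFin zero    c f = *-zeroʳ c
  *-sumFin (suc k) c f = trans (*-distribˡ-+ c (f zero) _) (cong (c * f zero +_) (*-sumFin k c (f ∘ suc)))

  sumFin-const : ∀ k c → sumFin k (λ _ → c) ≡ k * c
  sumFin-const zero    c = refl
  sumFin-const (suc k) c = cong (c +_) (sumFin-const k c)

  sumFin-mono-≤ : ∀ k {f g : Fin k → ℕ} → (∀ i → f i ≤ g i) → sumFin k f ≤ sumFin k g
  sumFin-mono-≤ zero    f≤g = z≤n
  sumFin-mono-≤ (suc k) f≤g = +-mono-≤ (f≤g zero) (sumFin-mono-≤ k (f≤g ∘ suc))

  f≤sumFin : ∀ k (f : Fin k → ℕ) i → f i ≤ sumFin k f
  f≤sumFin (suc k) f zero    = m≤m+n (f zero) _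
  f≤sumFin (suc k) f (suc i) = ≤-trans (f≤sumFin k (f ∘ suc) i) (m≤n+m _ (f zero))

  sumFin≡0⇒f≡0 : ∀ k (f : Fin k → ℕ) → sumFin k f ≡ 0 → ∀ i → f i ≡ 0
  sumFin≡0⇒f≡0 (suc k) f Σ≡0 zero    = m+n≡0⇒m≡0 (f zero) Σ≡0
  sumFin≡0⇒f≡0 (suc k) f Σ≡0 (suc i) = sumFin≡0⇒f≡0 k (f ∘ suc) (m+n≡0⇒n≡0 (f zero) Σ≡0) i

  ∣m+n-o+p∣≤∣m-o∣+∣n-p∣ : ∀ m n o p → ∣ m + n - o + p ∣ ≤ ∣ m - o ∣ + ∣ n - p ∣
  ∣m+n-o+p∣≤∣m-o∣+∣n-p∣ m n o p = begin
    ∣ m + n - o + p ∣                     ≤⟨ ∣-∣-triangle (m + n) (o + n) (o + p) ⟩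
    ∣ m + n - o + n ∣ + ∣ o + n - o + p ∣ ≡⟨ cong₂ _+_ (∣m+n-o+n∣≡∣m-o∣) (∣m+n-m+o∣≡∣n-o∣ o n p) ⟩
    ∣ m - o ∣ + ∣ n - p ∣                 ∎
    where
    open ≤-Reasoning
    ∣m+n-o+n∣≡∣m-o∣ : ∣ m + n - o + n ∣ ≡ ∣ m - o ∣
    ∣m+n-o+n∣≡∣m-o∣ rewrite +-comm m n | +-comm o n = ∣m+n-m+o∣≡∣n-o∣ n m o

  ∣sumFin-sumFin∣≤sumFin∣-∣ : ∀ k (f g : Fin k → ℕ) →
    ∣ sumFin k f - sumFin k g ∣ ≤ sumFin k (λ i → ∣ f i - g i ∣)
  ∣sumFin-sumFin∣≤sumFin∣-∣ zero    f g = z≤n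
  ∣sumFin-sumFin∣≤sumFin∣-∣ (suc k) f g =
    ≤-trans (∣m+n-o+p∣≤∣m-o∣+∣n-p∣ (f zero) _ (g zero) _)
            (+-monoʳ-≤ ∣ f zero - g zero ∣ (∣sumFin-sumFin∣≤sumFin∣-∣ k (f ∘ suc) (g ∘ suc)))

module Levels where
  open import Data.Nat using (ℕ; zero; suc; _+_; _*_; _∸_; _^_; _≤_; _<_; s≤s; z≤n; ∣_-_∣)
  open import Data.Nat.Properties
  open import Data.Fin using (Fin)
  open import Relation.Binary.PropositionalEquality
  open SumFin

  sizeAbove : Tree → ℕ → ℕ
  sizeAbove t zero    = 0
  sizeAbove t (suc ℓ) = sizeAbove t ℓ + levelSize t ℓ

  sizeFrom : Tree → ℕ → ℕ
  sizeFrom t          zero    = size t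
  sizeFrom (node k f) (suc ℓ) = sumFin k (λ i → sizeFrom (f i) ℓ)

  sizeFrom-suc : ∀ t ℓ → sizeFrom t ℓ ≡ levelSize t ℓ + sizeFrom t (suc ℓ)
  sizeFrom-suc (node k f) zero    = refl
  sizeFrom-suc (node k f) (suc ℓ) =
    trans (sumFin-cong k (λ i → sizeFrom-suc (f i) ℓ)) (sumFin-+ k _ _)

  size≡sizeAbove+sizeFrom : ∀ t ℓ → size t ≡ sizeAbove t ℓ + sizeFrom t ℓ
  size≡sizeAbove+sizeFrom t zero    = refl
  size≡sizeAbove+sizeFrom t (suc ℓ) = begin
    size t                                              ≡⟨ size≡sizeAbove+sizeFrom t ℓ ⟩
    sizeAbove t ℓ + sizeFrom t ℓ                        ≡⟨ cong (sizeAbove t ℓ +_) (sizeFrom-suc t ℓ) ⟩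
    sizeAbove t ℓ + (levelSize t ℓ + sizeFrom t (suc ℓ)) ≡⟨ +-assoc (sizeAbove t ℓ) _ _ ⟨
    sizeAbove t (suc ℓ) + sizeFrom t (suc ℓ)             ∎
    where open ≡-Reasoning

  sizeAbove-filled : ∀ d t ℓ → (∀ j → j < ℓ → Filled (suc d) t j) → suc (sizeAbove t ℓ * d) ≡ suc d ^ ℓ
  sizeAbove-filled d t zero    filled = refl
  sizeAbove-filled d t (suc ℓ) filled = begin
    suc ((sizeAbove t ℓ + levelSize t ℓ) * d) ≡⟨ cong (λ L → suc ((sizeAbove t ℓ + L) * d)) (filled ℓ ≤-refl) ⟩
    suc ((sizeAbove t ℓ + B) * d)             ≡⟨ cong suc (*-distribʳ-+ d (sizeAbove t ℓ) B) ⟩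
    suc (sizeAbove t ℓ * d) + B * d           ≡⟨ cong (_+ B * d) (sizeAbove-filled d t ℓ (λ j j<ℓ → filled j (m<n⇒m<1+n j<ℓ))) ⟩
    B + B * d                                 ≡⟨ cong (B +_) (*-comm B d) ⟩
    suc d ^ suc ℓ                             ∎
    where
    open ≡-Reasoning
    B = suc d ^ ℓ

  levelSize≤b^ℓ : ∀ {b} t ℓ → IsBary b t → levelSize t ℓ ≤ b ^ ℓ
  levelSize≤b^ℓ     t          zero    _                = s≤s z≤n
  levelSize≤b^ℓ {b} (node k f) (suc ℓ) (node k≤b fᵢ-bary) = begin
    sumFin k (λ i → levelSize (f i) ℓ) ≤⟨ sumFin-mono-≤ k (λ i → levelSize≤b^ℓ (f i) ℓ (fᵢ-bary i)) ⟩
    sumFin k (λ _ → b ^ ℓ)             ≡⟨ sumFin-const k (b ^ ℓ) ⟩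
    k * b ^ ℓ                          ≤⟨ *-monoˡ-≤ (b ^ ℓ) k≤b ⟩
    b * b ^ ℓ                          ∎
    where open ≤-Reasoning

  nonEmptyLevel-≤lev : ∀ {t} (x : Vertex t) j → j ≤ lev x → NonEmptyLevel t j
  nonEmptyLevel-≤lev x                 zero    _         = s≤s z≤n
  nonEmptyLevel-≤lev {node k f} (down i x) (suc j) (s≤s j≤lev) =
    ≤-trans (nonEmptyLevel-≤lev x j j≤lev) (f≤sumFin k (λ i → levelSize (f i) j) i)

  filled-<lev : ∀ {b t} → Balanced b t → (v : Vertex t) → ∀ j → j < lev v → Filled b t j
  filled-<lev bal v j j<lev =
    Balanced.filled bal j (lev v) j<lev (nonEmptyLevel-≤lev v j (<⇒≤ j<lev)) (nonEmptyLevel-≤lev v (lev v) ≤-refl)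

  nSub≡1-aboveEmptyLevel : ∀ t ℓ → levelSize t (suc ℓ) ≡ 0 → (x : Vertex t) → lev x ≡ ℓ → nSub t x ≡ 1
  nSub≡1-aboveEmptyLevel (node zero    f) zero    _     root       _ = refl
  nSub≡1-aboveEmptyLevel (node (suc k) f) zero    ()    root       _
  nSub≡1-aboveEmptyLevel (node k       f) (suc ℓ) empty (down i x) lev≡ =
    nSub≡1-aboveEmptyLevel (f i) ℓ (sumFin≡0⇒f≡0 k _ empty i) x (suc-injective lev≡)

  ∣c*levelSize-sizeFrom∣≤d*levelSize : ∀ t ℓ c d → (∀ (x : Vertex t) → lev x ≡ ℓ → ∣ c - nSub t x ∣ ≤ d) →
    ∣ c * levelSize t ℓ - sizeFrom t ℓ ∣ ≤ d * levelSize t ℓ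
  ∣c*levelSize-sizeFrom∣≤d*levelSize t zero c d close
    rewrite *-identityʳ c | *-identityʳ d = close root refl
  ∣c*levelSize-sizeFrom∣≤d*levelSize (node k f) (suc ℓ) c d close = begin
    ∣ c * sumFin k L - sumFin k S ∣               ≡⟨ cong ∣_- sumFin k S ∣ (*-sumFin k c L) ⟩
    ∣ sumFin k (λ i → c * L i) - sumFin k S ∣     ≤⟨ ∣sumFin-sumFin∣≤sumFin∣-∣ k _ S ⟩
    sumFin k (λ i → ∣ c * L i - S i ∣)            ≤⟨ sumFin-mono-≤ k (λ i → ∣c*levelSize-sizeFrom∣≤d*levelSize (f i) ℓ c d
                                                       (λ x lev≡ → close (down i x) (cong suc lev≡))) ⟩
    sumFin k (λ i → d * L i)                      ≡⟨ *-sumFin k d L ⟨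
    d * sumFin k L                                ∎
    where
    open ≤-Reasoning
    L S : Fin k → ℕ
    L i = levelSize (f i) ℓ
    S i = sizeFrom (f i) ℓ

  ∣nSub*b^lev-sizeFrom∣≤b^lev : ∀ {b t} → Balanced b t → (v : Vertex t) →
    ∣ nSub t v * b ^ lev v - sizeFrom t (lev v) ∣ ≤ b ^ lev v
  ∣nSub*b^lev-sizeFrom∣≤b^lev {b} {t} bal v with levelSize t (suc (lev v)) in nextSize
  ... | zero = begin
    ∣ nSub t v * B - S ∣ ≡⟨ cong (λ n → ∣ n * B - S ∣) (leaf v refl) ⟩
    ∣ 1 * B - S ∣        ≡⟨ cong ∣_- S ∣ (*-identityˡ B) ⟩
    ∣ B - S ∣            ≡⟨ m≤n⇒∣n-m∣≡n∸m S≤B ⟩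
    B ∸ S                ≤⟨ m∸n≤m B S ⟩
    B                    ∎
    where
    open ≤-Reasoning
    B = b ^ lev v
    L = levelSize t (lev v)
    S = sizeFrom t (lev v)
    leaf = nSub≡1-aboveEmptyLevel t (lev v) nextSize
    L≡S : 1 * L ≡ S
    L≡S = ∣m-n∣≡0⇒m≡n (n≤0⇒n≡0 (∣c*levelSize-sizeFrom∣≤d*levelSize t (lev v) 1 0
            (λ x lev≡ → ≤-reflexive (cong ∣ 1 -_∣ (leaf x lev≡)))))
    S≤B : S ≤ B
    S≤B = subst (_≤ B) L≡S (≤-trans (≤-reflexive (*-identityˡ L)) (levelSize≤b^ℓ t (lev v) (Balanced.bary bal)))
  ... | suc _ = subst (λ L → ∣ nSub t v * L - sizeFrom t (lev v) ∣ ≤ L) L≡B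
    (≤-trans (∣c*levelSize-sizeFrom∣≤d*levelSize t (lev v) (nSub t v) 1 (λ x lev≡ → Balanced.sizes bal v x (sym lev≡)))
             (≤-reflexive (*-identityˡ _)))
    where
    L≡B : levelSize t (lev v) ≡ b ^ lev v
    L≡B = Balanced.filled bal (lev v) (suc (lev v)) ≤-refl (nonEmptyLevel-≤lev v (lev v) ≤-refl)
            (subst (0 <_) (sym nextSize) (s≤s z≤n))

module NatEmbedding where
  open import Data.Nat as ℕ using (ℕ; suc; NonZero)
  import Data.Nat.Properties as ℕ
  import Data.Integer as ℤ
  import Data.Integer.Properties as ℤ
  open import Data.Integer using (+_)
  open import Data.Rational using (ℚ; _+_; _-_; _*_; -_; _/_; ∣_∣; 1ℚ; toℚᵘ; Positive) renaming (_≤_ to _≤ℚ_)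
  open import Data.Rational.Properties
  import Data.Rational.Unnormalised as ℚᵘ
  import Data.Rational.Unnormalised.Properties as ℚᵘ
  open import Data.Rational.Solver using (module +-*-Solver)
  open import Data.Sum using (inj₁; inj₂)
  open import Relation.Binary.PropositionalEquality
  open +-*-Solver

  fromℕ : ℕ → ℚ
  fromℕ n = + n / 1

  toℚᵘ-fromℕ : ∀ n → toℚᵘ (fromℕ n) ℚᵘ.≃ ℚᵘ.mkℚᵘ (+ n) 0
  toℚᵘ-fromℕ n = toℚᵘ-fromℚᵘ (ℚᵘ.mkℚᵘ (+ n) 0)

  fromℕ-+ : ∀ m n → fromℕ (m ℕ.+ n) ≡ fromℕ m + fromℕ n
  fromℕ-+ m n = toℚᵘ-injective (begin
    toℚᵘ (fromℕ (m ℕ.+ n))              ≈⟨ toℚᵘ-fromℕ (m ℕ.+ n) ⟩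
    ℚᵘ.mkℚᵘ (+ m ℤ.+ + n) 0             ≈⟨ ℚᵘ.*≡* (cong (ℤ._* + 1) (cong₂ ℤ._+_ (ℤ.*-identityʳ (+ m)) (ℤ.*-identityʳ (+ n)))) ⟨
    ℚᵘ.mkℚᵘ (+ m) 0 ℚᵘ.+ ℚᵘ.mkℚᵘ (+ n) 0 ≈⟨ ℚᵘ.+-cong (toℚᵘ-fromℕ m) (toℚᵘ-fromℕ n) ⟨
    toℚᵘ (fromℕ m) ℚᵘ.+ toℚᵘ (fromℕ n)  ≈⟨ toℚᵘ-homo-+ (fromℕ m) (fromℕ n) ⟨
    toℚᵘ (fromℕ m + fromℕ n)            ∎)
    where open ℚᵘ.≃-Reasoning

  fromℕ-* : ∀ m n → fromℕ (m ℕ.* n) ≡ fromℕ m * fromℕ n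
  fromℕ-* m n = toℚᵘ-injective (begin
    toℚᵘ (fromℕ (m ℕ.* n))               ≈⟨ toℚᵘ-fromℕ (m ℕ.* n) ⟩
    ℚᵘ.mkℚᵘ (+ (m ℕ.* n)) 0              ≈⟨ ℚᵘ.*≡* (cong (ℤ._* + 1) (ℤ.pos-* m n)) ⟩
    ℚᵘ.mkℚᵘ (+ m) 0 ℚᵘ.* ℚᵘ.mkℚᵘ (+ n) 0 ≈⟨ ℚᵘ.*-cong (toℚᵘ-fromℕ m) (toℚᵘ-fromℕ n) ⟨
    toℚᵘ (fromℕ m) ℚᵘ.* toℚᵘ (fromℕ n)   ≈⟨ toℚᵘ-homo-* (fromℕ m) (fromℕ n) ⟨
    toℚᵘ (fromℕ m * fromℕ n)             ∎)
    where open ℚᵘ.≃-Reasoning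

  fromℕ-mono-≤ : ∀ {m n} → m ℕ.≤ n → fromℕ m ≤ℚ fromℕ n
  fromℕ-mono-≤ {m} {n} m≤n = toℚᵘ-cancel-≤ (begin
    toℚᵘ (fromℕ m)  ≃⟨ toℚᵘ-fromℕ m ⟩
    ℚᵘ.mkℚᵘ (+ m) 0 ≤⟨ ℚᵘ.*≤* (ℤ.*-monoʳ-≤-nonNeg (+ 1) (ℤ.+≤+ m≤n)) ⟩
    ℚᵘ.mkℚᵘ (+ n) 0 ≃⟨ toℚᵘ-fromℕ n ⟨
    toℚᵘ (fromℕ n)  ∎)
    where open ℚᵘ.≤-Reasoning

  +[m*n]/n≡fromℕm : ∀ m n .{{_ : NonZero n}} → (+ (m ℕ.* n)) / n ≡ fromℕ m
  +[m*n]/n≡fromℕm m (suc n) = toℚᵘ-injective (begin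
    toℚᵘ ((+ (m ℕ.* suc n)) / suc n) ≈⟨ toℚᵘ-fromℚᵘ (ℚᵘ.mkℚᵘ (+ (m ℕ.* suc n)) n) ⟩
    ℚᵘ.mkℚᵘ (+ (m ℕ.* suc n)) n      ≈⟨ ℚᵘ.*≡* (trans (ℤ.*-identityʳ _) (ℤ.pos-* m (suc n))) ⟩
    ℚᵘ.mkℚᵘ (+ m) 0                 ≈⟨ toℚᵘ-fromℕ m ⟨
    toℚᵘ (fromℕ m)                  ∎)
    where open ℚᵘ.≃-Reasoning

  1/n*fromℕn≡1 : ∀ n .{{_ : NonZero n}} → (+ 1) / n * fromℕ n ≡ 1ℚ
  1/n*fromℕn≡1 (suc n) = toℚᵘ-injective (begin
    toℚᵘ ((+ 1) / suc n * fromℕ (suc n))             ≈⟨ toℚᵘ-homo-* ((+ 1) / suc n) (fromℕ (suc n)) ⟩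
    toℚᵘ ((+ 1) / suc n) ℚᵘ.* toℚᵘ (fromℕ (suc n))   ≈⟨ ℚᵘ.*-cong (toℚᵘ-fromℚᵘ (ℚᵘ.mkℚᵘ (+ 1) n)) (toℚᵘ-fromℕ (suc n)) ⟩
    ℚᵘ.mkℚᵘ (+ 1) n ℚᵘ.* ℚᵘ.mkℚᵘ (+ suc n) 0         ≈⟨ ℚᵘ.*≡* (cong (λ k → + suc k) (trans (ℕ.*-identityʳ (n ℕ.+ 0)) (cong (ℕ._+ 0) (sym (ℕ.*-identityʳ n))))) ⟩
    ℚᵘ.1ℚᵘ                                          ∎)
    where open ℚᵘ.≃-Reasoning

  fromℕ[a+s]-[a*d]/d≡fromℕs : ∀ a s d .{{_ : NonZero d}} → fromℕ (a ℕ.+ s) - (+ (a ℕ.* d)) / d ≡ fromℕ s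
  fromℕ[a+s]-[a*d]/d≡fromℕs a s d = begin
    fromℕ (a ℕ.+ s) - (+ (a ℕ.* d)) / d ≡⟨ cong₂ _-_ (fromℕ-+ a s) (+[m*n]/n≡fromℕm a d) ⟩
    fromℕ a + fromℕ s - fromℕ a         ≡⟨ solve 2 (λ x y → x :+ y :- x := y) refl (fromℕ a) (fromℕ s) ⟩
    fromℕ s                             ∎
    where open ≡-Reasoning

  ∣fromℕn∣≡fromℕn : ∀ n → ∣ fromℕ n ∣ ≡ fromℕ n
  ∣fromℕn∣≡fromℕn n = 0≤p⇒∣p∣≡p (fromℕ-mono-≤ {0} {n} ℕ.z≤n)

  fromℕ-∸ : ∀ {m n} → n ℕ.≤ m → fromℕ (m ℕ.∸ n) ≡ fromℕ m - fromℕ n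
  fromℕ-∸ {m} {n} n≤m = begin
    fromℕ (m ℕ.∸ n)                      ≡⟨ solve 2 (λ x y → y := (x :+ y) :- x) refl (fromℕ n) (fromℕ (m ℕ.∸ n)) ⟩
    fromℕ n + fromℕ (m ℕ.∸ n) - fromℕ n  ≡⟨ cong (_- fromℕ n) (fromℕ-+ n (m ℕ.∸ n)) ⟨
    fromℕ (n ℕ.+ (m ℕ.∸ n)) - fromℕ n    ≡⟨ cong (λ k → fromℕ k - fromℕ n) (ℕ.m+[n∸m]≡n n≤m) ⟩
    fromℕ m - fromℕ n                    ∎
    where open ≡-Reasoning

  ∣fromℕm-fromℕn∣≡fromℕ[m∸n] : ∀ {m n} → n ℕ.≤ m → ∣ fromℕ m - fromℕ n ∣ ≡ fromℕ (m ℕ.∸ n)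
  ∣fromℕm-fromℕn∣≡fromℕ[m∸n] {m} {n} n≤m =
    trans (cong ∣_∣ (sym (fromℕ-∸ n≤m))) (∣fromℕn∣≡fromℕn (m ℕ.∸ n))

  ∣fromℕm-fromℕn∣≡fromℕ∣m-n∣ : ∀ m n → ∣ fromℕ m - fromℕ n ∣ ≡ fromℕ ℕ.∣ m - n ∣
  ∣fromℕm-fromℕn∣≡fromℕ∣m-n∣ m n with ℕ.≤-total n m
  ... | inj₁ n≤m = trans (∣fromℕm-fromℕn∣≡fromℕ[m∸n] n≤m) (cong fromℕ (sym (ℕ.m≤n⇒∣n-m∣≡n∸m n≤m)))
  ... | inj₂ m≤n = begin
    ∣ fromℕ m - fromℕ n ∣       ≡⟨ cong ∣_∣ (solve 2 (λ x y → x :- y := :- (y :- x)) refl (fromℕ m) (fromℕ n)) ⟩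
    ∣ - (fromℕ n - fromℕ m) ∣   ≡⟨ ∣-p∣≡∣p∣ (fromℕ n - fromℕ m) ⟩
    ∣ fromℕ n - fromℕ m ∣       ≡⟨ ∣fromℕm-fromℕn∣≡fromℕ[m∸n] m≤n ⟩
    fromℕ (n ℕ.∸ m)             ≡⟨ cong fromℕ (ℕ.m≤n⇒∣m-n∣≡n∸m m≤n) ⟨
    fromℕ ℕ.∣ m - n ∣           ∎
    where open ≡-Reasoning

  [m-n*1/o]*o≡m*o-n : ∀ m n o .{{_ : NonZero o}} →
    (fromℕ m - fromℕ n * ((+ 1) / o)) * fromℕ o ≡ fromℕ (m ℕ.* o) - fromℕ n
  [m-n*1/o]*o≡m*o-n m n o = begin
    (fromℕ m - fromℕ n * ((+ 1) / o)) * fromℕ o          ≡⟨ solve 4 (λ x y i z → (x :- y :* i) :* z := x :* z :- y :* (i :* z)) refl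
                                                              (fromℕ m) (fromℕ n) ((+ 1) / o) (fromℕ o) ⟩
    fromℕ m * fromℕ o - fromℕ n * ((+ 1) / o * fromℕ o)  ≡⟨ cong₂ (λ x i → x - fromℕ n * i) (fromℕ-* m o) (sym (1/n*fromℕn≡1 o)) ⟨
    fromℕ (m ℕ.* o) - fromℕ n * 1ℚ                       ≡⟨ cong (λ y → fromℕ (m ℕ.* o) - y) (*-identityʳ (fromℕ n)) ⟩
    fromℕ (m ℕ.* o) - fromℕ n                            ∎
    where open ≡-Reasoning

  ∣m*o-n∣≤o⇒∣m-n*1/o∣≤1 : ∀ m n o .{{_ : NonZero o}} →
    ℕ.∣ m ℕ.* o - n ∣ ℕ.≤ o → ∣ fromℕ m - fromℕ n * ((+ 1) / o) ∣ ≤ℚ 1ℚ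
  ∣m*o-n∣≤o⇒∣m-n*1/o∣≤1 m n o close = *-cancelʳ-≤-pos (fromℕ o) (begin
    ∣ β ∣ * fromℕ o                  ≡⟨ cong (∣ β ∣ *_) (∣fromℕn∣≡fromℕn o) ⟨
    ∣ β ∣ * ∣ fromℕ o ∣              ≡⟨ ∣p*q∣≡∣p∣*∣q∣ β (fromℕ o) ⟨
    ∣ β * fromℕ o ∣                  ≡⟨ cong ∣_∣ ([m-n*1/o]*o≡m*o-n m n o) ⟩
    ∣ fromℕ (m ℕ.* o) - fromℕ n ∣    ≡⟨ ∣fromℕm-fromℕn∣≡fromℕ∣m-n∣ (m ℕ.* o) n ⟩
    fromℕ ℕ.∣ m ℕ.* o - n ∣          ≤⟨ fromℕ-mono-≤ close ⟩
    fromℕ o                          ≡⟨ *-identityˡ (fromℕ o) ⟨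
    1ℚ * fromℕ o                     ∎)
    where
    open ≤-Reasoning
    β = fromℕ m - fromℕ n * ((+ 1) / o)
    instance
      _ : Positive (fromℕ o)
      _ = normalize-pos o 1

open import Data.Nat as ℕ using (ℕ; suc; pred; _≤_; _∸_; _^_; s≤s; z≤n; NonZero)
open import Data.Nat.Properties using (m^n≢0)
open import Data.Integer using (+_)
open import Data.Rational using (ℚ; _+_; _-_; _*_; _/_; ∣_∣; 1ℚ) renaming (_≤_ to _≤ℚ_)
open import Data.Rational.Solver using (module +-*-Solver)
open import Data.Product using (∃-syntax; _×_; _,_)
open import Relation.Binary.PropositionalEquality using (_≡_; refl; cong; cong₂; sym; subst; module ≡-Reasoning)
open +-*-Solver
open Levels
open NatEmbedding

lemma10 : (b : ℕ) (b≥2 : 2 ≤ b) (T : Tree) → Balanced b T →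
    (v : Vertex T) →
    ∃[ β ] (((+ nSub T v) / 1 ≡ formula b b≥2 (size T) (lev v) + β) × ∣ β ∣ ≤ℚ (+ 1) / 1)
lemma10 (suc (suc c)) b≥2@(s≤s (s≤s z≤n)) T bal v =
  fromℕ (nSub T v) - formula b b≥2 (size T) ℓ ,
  solve 2 (λ x y → x := y :+ (x :- y)) refl (fromℕ (nSub T v)) (formula b b≥2 (size T) ℓ) ,
  subst (λ q → ∣ fromℕ (nSub T v) - q ∣ ≤ℚ 1ℚ) (sym formula≡S/B)
    (∣m*o-n∣≤o⇒∣m-n*1/o∣≤1 (nSub T v) (sizeFrom T ℓ) (b ^ ℓ) (∣nSub*b^lev-sizeFrom∣≤b^lev bal v))
  where
  b = suc (suc c)
  ℓ = lev v
  instance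
    _ : NonZero (b ^ ℓ)
    _ = m^n≢0 b ℓ
  b^ℓ∸1≡sizeAbove*[b∸1] : b ^ ℓ ∸ 1 ≡ sizeAbove T ℓ ℕ.* suc c
  b^ℓ∸1≡sizeAbove*[b∸1] = cong pred (sym (sizeAbove-filled (suc c) T ℓ (filled-<lev bal v)))
  formula≡S/B : formula b b≥2 (size T) ℓ ≡ fromℕ (sizeFrom T ℓ) * ((+ 1) / b ^ ℓ)
  formula≡S/B = begin
    (fromℕ (size T) - (+ (b ^ ℓ ∸ 1)) / suc c) * ((+ 1) / b ^ ℓ)
      ≡⟨ cong₂ (λ n a → (fromℕ n - (+ a) / suc c) * ((+ 1) / b ^ ℓ)) (size≡sizeAbove+sizeFrom T ℓ) b^ℓ∸1≡sizeAbove*[b∸1] ⟩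
    (fromℕ (sizeAbove T ℓ ℕ.+ sizeFrom T ℓ) - (+ (sizeAbove T ℓ ℕ.* suc c)) / suc c) * ((+ 1) / b ^ ℓ)
      ≡⟨ cong (_* ((+ 1) / b ^ ℓ)) (fromℕ[a+s]-[a*d]/d≡fromℕs (sizeAbove T ℓ) (sizeFrom T ℓ) (suc c)) ⟩
    fromℕ (sizeFrom T ℓ) * ((+ 1) / b ^ ℓ) ∎
    where open ≡-Reasoning
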